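{- Let $\ell\geq 2$ and $n_1,\ldots,n_\ell\geq 2$ be integers. Then $\mathcal{R}(K_{n_1,\ldots,n_\ell})\cong AFR(n_1,\ldots,n_\ell)$.
   Context: All graphs are finite, simple and undirected; $N(v)$ denotes the open neighbourhood of $v$. A set $S\subseteq V(G)$ is a dominating set if every vertex of $G$ is in $S$ or adjacent to a vertex of $S$; it is a minimal dominating set if no proper subset of $S$ is a dominating set. The reconfiguration graph $\mathcal{R}(G)$ has as vertex set the collection of all minimal dominating sets of $G$, and two minimal dominating sets $M_1,M_2$ are adjacent iff there is a vertex $v$ with either ($M_2\setminus M_1=\{v\}$ and $M_1\setminus M_2\subseteq N(v)$) or ($M_1\setminus M_2=\{v\}$ and $M_2\setminus M_1\subseteq N(v)$). $K_{n_1,\ldots,n_\ell}$ is the complete multipartite graph with parts of sizes $n_1,\ldots,n_\ell$. The altered folded rook's graph $AFR(n_1,\ldots,n_\ell)$: let $n=n_1+\cdots+n_\ell$ and partition $\{1,\ldots,n\}$ into consecutive blocks $N_1,\ldots,N_\ell$, where $N_k=\{n_1+\cdots+n_{k-1}+1,\ldots,n_1+\cdots+n_k\}$. Start from the $n$ by $n$ folded rook's graph, whose vertices are the pairs $(i,j)$ with $1\le j\le i\le n$ and where $(i,j)\sim(k,l)$ (distinct) iff $\{i,j\}\cap\{k,l\}\neq\emptyset$. Then: for each $k$, contract all vertices $(i,j)$ with $i,j\in N_k$ into a single vertex, labelled $k$ (adjacent to every vertex outside that was adjacent to one of the contracted vertices); and for each $k\neq m$, delete all edges between two vertices both of which lie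 in $N_k\times N_m$. Equivalently, $AFR(n_1,\ldots,n_\ell)$ has vertices $1,\ldots,\ell$ together with all pairs $(i,j)$, $j<i$, with $i,j$ in different blocks; vertex $k$ is adjacent to $(i,j)$ iff $\{i,j\}\cap N_k\neq\emptyset$; the vertices $1,\ldots,\ell$ are pairwise non-adjacent; and distinct pairs $(i,j),(i',j')$ are adjacent iff $\{i,j\}\cap\{i',j'\}\neq\emptyset$ and they do not both lie in $N_k\times N_m$ for the same $k\neq m$. -}

module Defs where

open import Data.Nat as ℕ using (ℕ; zero; suc)
open import Data.Fin as Fin using (Fin; splitAt)
open import Data.Fin.Properties using (_≟_; _<?_; any?; all?)
open import Data.Fin.Subset using (Subset; _∈_; _∉_; _⊂_; _─_; ⁅_⁆)
open import Data.Fin.Subset.Properties using (_∈?_; anySubset?)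
open import Data.Vec using (Vec; []; _∷_; sum)
open import Data.Product using (Σ; ∃; _×_; _,_; proj₁; proj₂)
open import Data.Sum using (_⊎_; inj₁; inj₂)
open import Data.Empty using (⊥)
open import Relation.Nullary using (¬_; Dec; yes; no)
open import Relation.Nullary.Decidable using (True; False; _×-dec_; _⊎-dec_; ¬?)
open import Relation.Binary.PropositionalEquality using (_≡_; _≢_)
open import Function.Bundles using (_⤖_; _⇔_; Bijection)

record Graph : Set₁ where
  field
    V   : Set
    Adj : V → V → Set

open Graph public

_≅_ : Graph → Graph → Set
G ≅ H = Σ (V G ⤖ V H) λ f →
  ∀ x y → Adj G x y ⇔ Adj H (Bijection.to f x) (Bijection.to f y)

record FinGraph (n : ℕ) : Set₁ where
  field
    Adj  : Fin n → Fin n → Set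
    adj? : ∀ u v → Dec (Adj u v)

open FinGraph public using (adj?)

module _ {n : ℕ} (G : FinGraph n) where
  private A = FinGraph.Adj G

  Dominating : Subset n → Set
  Dominating S = ∀ v → v ∈ S ⊎ ∃ λ u → u ∈ S × A v u

  dominating? : ∀ S → Dec (Dominating S)
  dominating? S = all? λ v → (v ∈? S) ⊎-dec any? (λ u → (u ∈? S) ×-dec adj? G v u)

  MinDominating : Subset n → Set
  MinDominating S = Dominating S × ¬ (∃ λ T → T ⊂ S × Dominating T)

  minDominating? : ∀ S → Dec (MinDominating S)
  minDominating? S =
    dominating? S ×-dec ¬? (anySubset? λ T → (T Data.Fin.Subset.Properties.⊂? S) ×-dec dominating? T)

  -- the vertices of the reconfiguration graph: minimal dominating sets
  -- (the proof component is T of a boolean, hence proof-irrelevant)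
  MDS : Set
  MDS = Σ (Subset n) λ S → True (minDominating? S)

  Step : Subset n → Subset n → Fin n → Set
  Step M₁ M₂ v = (M₂ ─ M₁ ≡ ⁅ v ⁆) × (∀ u → u ∈ M₁ ─ M₂ → A v u)

  R : Graph
  R = record
    { V   = MDS
    ; Adj = λ M₁ M₂ → ∃ λ v → Step (proj₁ M₁) (proj₁ M₂) v ⊎ Step (proj₁ M₂) (proj₁ M₁) v
    }

-- Blocks: {0,…,n-1} (n = n₁+⋯+n_ℓ) split into consecutive blocks N_1,…,N_ℓ
-- block ns i = the index k of the block N_k containing i

block : ∀ {ℓ} (ns : Vec ℕ ℓ) → Fin (sum ns) → Fin ℓ
block (m ∷ ns) i with splitAt m i
... | inj₁ _ = Fin.zero
... | inj₂ j = Fin.suc (block ns j)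

K : ∀ {ℓ} (ns : Vec ℕ ℓ) → FinGraph (sum ns)
K ns = record
  { Adj  = λ u v → block ns u ≢ block ns v
  ; adj? = λ u v → ¬? (block ns u ≟ block ns v)
  }

module _ {ℓ : ℕ} (ns : Vec ℕ ℓ) where
  private
    n = sum ns
    b = block ns

  Pair : Set
  Pair = Σ (Fin n × Fin n) λ p →
    True (proj₂ p <? proj₁ p) × False (b (proj₁ p) ≟ b (proj₂ p))

  AFRV : Set
  AFRV = Fin ℓ ⊎ Pair

  Meet : Fin n × Fin n → Fin n × Fin n → Set
  Meet (i , j) (i' , j') = (i ≡ i') ⊎ (i ≡ j') ⊎ (j ≡ i') ⊎ (j ≡ j')

  SameBlocks : Fin n × Fin n → Fin n × Fin n → Set
  SameBlocks (i , j) (i' , j') = ∃ λ k → ∃ λ m → k ≢ m ×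
    (b i ≡ k × b j ≡ m) × (b i' ≡ k × b j' ≡ m)

  AFRAdj : AFRV → AFRV → Set
  AFRAdj (inj₁ k) (inj₁ m) = ⊥
  AFRAdj (inj₁ k) (inj₂ ((i , j) , _)) = (b i ≡ k) ⊎ (b j ≡ k)
  AFRAdj (inj₂ ((i , j) , _)) (inj₁ k) = (b i ≡ k) ⊎ (b j ≡ k)
  AFRAdj (inj₂ (p , _)) (inj₂ (q , _)) = p ≢ q × Meet p q × ¬ SameBlocks p q

  AFR : Graph
  AFR = record { V = AFRV ; Adj = AFRAdj }

{-# OPTIONS --safe #-}
-- In K_{n₁,…,n_ℓ} a vertex dominates exactly the vertices outside its own part.  When every part
-- has at least two vertices, each part N_k is a minimal dominating set, and so is each pair {i, j}
-- of vertices from different parts (i has a private neighbour in the part of j and vice versa);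
-- a minimal dominating set meeting two parts contains such a pair, hence equals it, and one
-- meeting a single part is that part.  A reconfiguration step adds one vertex v and may remove
-- only vertices outside the part of v.  Hence two parts are never adjacent (N_m ∖ N_k has two
-- elements), N_k and {i, j} are adjacent iff the pair meets N_k, and two pairs are adjacent iff
-- they share a vertex and the two exchanged vertices lie in different parts.  Writing pairs as
-- (i, j) with j < i and using that parts are intervals, this last condition fails exactly when
-- both pairs lie in the same N_k × N_m, which is the edge deletion defining AFR.

module Submission where

open import Defs
open import Level using (0ℓ)
open import Data.Empty using (⊥)
open import Data.Nat using (ℕ; _≤_; _<_; _+_; suc; s≤s; z≤n)
import Data.Nat.Properties as ℕ
open import Data.Fin as Fin using (Fin; zero; suc; toℕ; splitAt; _↑ˡ_; _↑ʳ_)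
open import Data.Fin.Properties
  using (_≟_; any?; toℕ<n; toℕ-↑ˡ; toℕ-↑ʳ; splitAt-↑ˡ; splitAt-↑ʳ; splitAt⁻¹-↑ˡ; splitAt⁻¹-↑ʳ;
         ↑ˡ-injective; ↑ʳ-injective; ≤-antisym; <-cmp; <-irrefl; <-asym; <-trans)
open import Data.Fin.Subset using (Subset; outside; _∈_; _∉_; _⊆_; _⊂_; _─_; _∪_; ⁅_⁆; Nonempty)
open import Data.Fin.Subset.Properties
  using (_∈?_; x∈⁅x⁆; x∈⁅y⁆⇒x≡y; ⊆-antisym; x∈p∪q⁻; p⊆p∪q; q⊆p∪q; ∪-comm; x∈p∧x∉q⇒x∈p─q; p─q⊆p)
open import Data.Vec using (Vec; _∷_; lookup; sum; tabulate; here; there)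
open import Data.Vec.Properties using ([]=⇒lookup; lookup⇒[]=; lookup∘tabulate)
open import Data.Bool.Properties using (T-≡; T-irrelevant)
open import Data.Product using (∃; ∃₂; _×_; _,_; proj₁; proj₂; map₂)
open import Data.Sum as Sum using (_⊎_; inj₁; inj₂; [_,_]′)
open import Function using (_∘_; id)
open import Function.Bundles using (_⇔_; mk⇔; mk⤖; Bijection; Equivalence)
open import Function.Consequences.Propositional using (strictlySurjective⇒surjective)
open import Function.Properties.Bijection using (sym-≡)
import Function.Properties.Equivalence as ⇔
open import Relation.Binary.Definitions using (tri<; tri≈; tri>)
open import Relation.Binary.PropositionalEquality
  using (_≡_; _≢_; refl; sym; trans; cong; cong₂; subst; subst₂)
open import Relation.Nullary using (¬_; yes; no; contradiction)
open import Relation.Nullary.Decidable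
  using (isYes; toWitness; fromWitness; toWitnessFalse; fromWitnessFalse; _×-dec_; ¬?)
open import Relation.Unary using (Pred; Decidable)

≅-sym : ∀ {G H} → G ≅ H → H ≅ G
≅-sym {G} {H} (f , f-adj) = sym-≡ f , λ x y →
  subst₂ (λ x′ y′ → Adj H x′ y′ ⇔ Adj G (to⁻ x) (to⁻ y)) (to∘to⁻ x) (to∘to⁻ y)
         (⇔.sym (f-adj (to⁻ x) (to⁻ y)))
  where
  open Bijection f using (to; to⁻; strictlySurjective)
  to∘to⁻ : ∀ y → to (to⁻ y) ≡ y
  to∘to⁻ = proj₂ ∘ strictlySurjective

x∈p─q⇒x∉q : ∀ {n} {p q : Subset n} {x} → x ∈ p ─ q → x ∉ q
x∈p─q⇒x∉q {p = _ ∷ _} {outside ∷ _} here ()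
x∈p─q⇒x∉q {p = _ ∷ _} {_ ∷ _} (there x∈p─q) (there x∈q) = x∈p─q⇒x∉q x∈p─q x∈q

module _ {n : ℕ} {P : Pred (Fin n) 0ℓ} (P? : Decidable P) where

  ⟦_⟧ : Subset n
  ⟦_⟧ = tabulate (isYes ∘ P?)

  ∈⟦⟧⁺ : ∀ {x} → P x → x ∈ ⟦_⟧
  ∈⟦⟧⁺ {x} px = lookup⇒[]= x _ (trans (lookup∘tabulate _ x) (Equivalence.to T-≡ (fromWitness px)))

  ∈⟦⟧⁻ : ∀ {x} → x ∈ ⟦_⟧ → P x
  ∈⟦⟧⁻ {x} x∈ = toWitness (Equivalence.from T-≡ (trans (sym (lookup∘tabulate _ x)) ([]=⇒lookup x∈)))

module _ {n : ℕ} where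

  pair : Fin n → Fin n → Subset n
  pair i j = ⁅ i ⁆ ∪ ⁅ j ⁆

  ∈pair⁻ : ∀ {i j x} → x ∈ pair i j → x ≡ i ⊎ x ≡ j
  ∈pair⁻ {i} {j} x∈ = Sum.map (x∈⁅y⁆⇒x≡y i) (x∈⁅y⁆⇒x≡y j) (x∈p∪q⁻ ⁅ i ⁆ ⁅ j ⁆ x∈)

  i∈pair : ∀ {i j} → i ∈ pair i j
  i∈pair {i} {j} = p⊆p∪q ⁅ j ⁆ (x∈⁅x⁆ i)

  j∈pair : ∀ {i j} → j ∈ pair i j
  j∈pair {i} {j} = q⊆p∪q ⁅ i ⁆ ⁅ j ⁆ (x∈⁅x⁆ j)

  ∉pair : ∀ {i j x} → x ≢ i → x ≢ j → x ∉ pair i j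
  ∉pair x≢i x≢j x∈ = [ x≢i , x≢j ]′ (∈pair⁻ x∈)

  pair-comm : ∀ i j → pair i j ≡ pair j i
  pair-comm i j = ∪-comm ⁅ i ⁆ ⁅ j ⁆

  pair-injective : ∀ {i j i′ j′} → j Fin.< i → j′ Fin.< i′ → pair i j ≡ pair i′ j′ → i ≡ i′ × j ≡ j′
  pair-injective {i} {j} j<i j′<i′ eq
    with ∈pair⁻ (subst (i ∈_) eq i∈pair) | ∈pair⁻ (subst (j ∈_) eq j∈pair)
  ... | inj₁ i≡i′ | inj₂ j≡j′ = i≡i′ , j≡j′
  ... | inj₁ i≡i′ | inj₁ j≡i′ = contradiction (trans j≡i′ (sym i≡i′)) (λ j≡i → <-irrefl j≡i j<i)
  ... | inj₂ i≡j′ | inj₂ j≡j′ = contradiction (trans j≡j′ (sym i≡j′)) (λ j≡i → <-irrefl j≡i j<i)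
  ... | inj₂ i≡j′ | inj₁ j≡i′ = contradiction (subst₂ Fin._<_ (sym i≡j′) (sym j≡i′) j′<i′) (<-asym j<i)

twoDistinct : ∀ {m} → 2 ≤ m → ∃₂ λ (s t : Fin m) → s ≢ t
twoDistinct (s≤s (s≤s _)) = zero , suc zero , λ ()

element : ∀ {ℓ} (ns : Vec ℕ ℓ) (k : Fin ℓ) → Fin (lookup ns k) → Fin (sum ns)
element (m ∷ ns) zero    t = t ↑ˡ sum ns
element (m ∷ ns) (suc k) t = m ↑ʳ element ns k t

block-element : ∀ {ℓ} (ns : Vec ℕ ℓ) k t → block ns (element ns k t) ≡ k
block-element (m ∷ ns) zero    t rewrite splitAt-↑ˡ m t (sum ns) = refl
block-element (m ∷ ns) (suc k) t rewrite splitAt-↑ʳ m (sum ns) (element ns k t) =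
  cong suc (block-element ns k t)

element-injective : ∀ {ℓ} (ns : Vec ℕ ℓ) k {t t′} → element ns k t ≡ element ns k t′ → t ≡ t′
element-injective (m ∷ ns) zero    = ↑ˡ-injective (sum ns) _ _
element-injective (m ∷ ns) (suc k) = element-injective ns k ∘ ↑ʳ-injective m _ _

toℕ-splitAt-inj₁ : ∀ m {n} {i : Fin (m + n)} {c} → splitAt m i ≡ inj₁ c → toℕ i ≡ toℕ c
toℕ-splitAt-inj₁ m {n} {c = c} eq = trans (cong toℕ (sym (splitAt⁻¹-↑ˡ eq))) (toℕ-↑ˡ c n)

toℕ-splitAt-inj₂ : ∀ m {n} {i : Fin (m + n)} {a} → splitAt m i ≡ inj₂ a → toℕ i ≡ m + toℕ a
toℕ-splitAt-inj₂ m {a = a} eq = trans (cong toℕ (sym (splitAt⁻¹-↑ʳ eq))) (toℕ-↑ʳ m a)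

block-mono : ∀ {ℓ} (ns : Vec ℕ ℓ) {i j} → i Fin.≤ j → block ns i Fin.≤ block ns j
block-mono (m ∷ ns) {i} {j} i≤j with splitAt m i in eqi | splitAt m j in eqj
... | inj₁ _ | _      = z≤n
... | inj₂ a | inj₁ c = contradiction m<m (ℕ.<-irrefl refl)
  where
  open ℕ.≤-Reasoning
  m<m : m < m
  m<m = begin-strict
    m          ≤⟨ ℕ.m≤m+n m (toℕ a) ⟩
    m + toℕ a  ≡⟨ toℕ-splitAt-inj₂ m eqi ⟨
    toℕ i      ≤⟨ i≤j ⟩
    toℕ j      ≡⟨ toℕ-splitAt-inj₁ m eqj ⟩
    toℕ c      <⟨ toℕ<n c ⟩
    m          ∎
... | inj₂ a | inj₂ c = s≤s (block-mono ns (ℕ.+-cancelˡ-≤ m _ _ m+a≤m+c))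
  where
  open ℕ.≤-Reasoning
  m+a≤m+c : m + toℕ a ≤ m + toℕ c
  m+a≤m+c = begin
    m + toℕ a  ≡⟨ toℕ-splitAt-inj₂ m eqi ⟨
    toℕ i      ≤⟨ i≤j ⟩
    toℕ j      ≡⟨ toℕ-splitAt-inj₂ m eqj ⟩
    m + toℕ c  ∎

block-convex : ∀ {ℓ} (ns : Vec ℕ ℓ) {i j k} → i Fin.≤ j → j Fin.≤ k →
               block ns i ≡ block ns k → block ns j ≡ block ns i
block-convex ns i≤j j≤k bi≡bk =
  ≤-antisym (subst (block ns _ Fin.≤_) (sym bi≡bk) (block-mono ns j≤k)) (block-mono ns i≤j)

module _ {n : ℕ} (G : FinGraph n) where

  open FinGraph G using () renaming (Adj to _~_)

  PrivateNeighbour : Subset n → Fin n → Fin n → Set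
  PrivateNeighbour S x w = ∀ {u} → u ∈ S → u ≡ w ⊎ w ~ u → u ≡ x

  privateNeighbours⇒minDominating : ∀ {S} → Dominating G S →
    (∀ {x} → x ∈ S → ∃ (PrivateNeighbour S x)) → MinDominating G S
  privateNeighbours⇒minDominating {S} dom pn = dom , minimal
    where
    minimal : ¬ (∃ λ T → T ⊂ S × Dominating G T)
    minimal (T , (T⊆S , x , x∈S , x∉T) , domT) with pn x∈S
    ... | w , w-private =
      [ (λ w∈T → dominatedBy w∈T (inj₁ refl)) , (λ (u , u∈T , w~u) → dominatedBy u∈T (inj₂ w~u)) ]′
      (domT w)
      where
      dominatedBy : ∀ {u} → u ∈ T → u ≡ w ⊎ w ~ u → ⊥
      dominatedBy u∈T near = x∉T (subst (_∈ T) (w-private (T⊆S u∈T) near) u∈T)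

  minDominating-⊆-dominating⇒≡ : ∀ {S T} → MinDominating G S → T ⊆ S → Dominating G T → T ≡ S
  minDominating-⊆-dominating⇒≡ {S} {T} (_ , minimal) T⊆S domT = ⊆-antisym T⊆S S⊆T
    where
    S⊆T : S ⊆ T
    S⊆T {x} x∈S with x ∈? T
    ... | yes x∈T = x∈T
    ... | no  x∉T = contradiction (T , ((λ {_} → T⊆S) , x , x∈S , x∉T) , domT) minimal

  dominating⇒nonempty : ∀ {S} → Fin n → Dominating G S → Nonempty S
  dominating⇒nonempty x dom = [ (λ x∈S → x , x∈S) , (λ (u , u∈S , _) → u , u∈S) ]′ (dom x)

  MDS-≡ : {M M′ : MDS G} → proj₁ M ≡ proj₁ M′ → M ≡ M′
  MDS-≡ {S , p} {.S , q} refl = cong (S ,_) (T-irrelevant p q)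

  record IsStep (P Q : Subset n) (v : Fin n) : Set where
    field
      v∈Q       : v ∈ Q
      v∉P       : v ∉ P
      ∈Q─P⇒≡v   : ∀ {x} → x ∈ Q → x ∉ P → x ≡ v
      ∈P─Q⇒v~   : ∀ {u} → u ∈ P → u ∉ Q → v ~ u

  Step⁺ : ∀ {P Q v} → IsStep P Q v → Step G P Q v
  Step⁺ {P} {Q} {v} s = ⊆-antisym Q─P⊆v v⊆Q─P , λ u u∈P─Q → ∈P─Q⇒v~ (p─q⊆p P Q u∈P─Q) (x∈p─q⇒x∉q u∈P─Q)
    where
    open IsStep s
    Q─P⊆v : Q ─ P ⊆ ⁅ v ⁆
    Q─P⊆v x∈Q─P = subst (_∈ ⁅ v ⁆) (sym (∈Q─P⇒≡v (p─q⊆p Q P x∈Q─P) (x∈p─q⇒x∉q x∈Q─P))) (x∈⁅x⁆ v)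
    v⊆Q─P : ⁅ v ⁆ ⊆ Q ─ P
    v⊆Q─P x∈v = subst (_∈ Q ─ P) (sym (x∈⁅y⁆⇒x≡y v x∈v)) (x∈p∧x∉q⇒x∈p─q v∈Q v∉P)

  Step⁻ : ∀ {P Q v} → Step G P Q v → IsStep P Q v
  Step⁻ {P} {Q} {v} (Q─P≡v , P─Q⊆N[v]) = record
    { v∈Q     = p─q⊆p Q P v∈Q─P
    ; v∉P     = x∈p─q⇒x∉q v∈Q─P
    ; ∈Q─P⇒≡v = λ x∈Q x∉P → x∈⁅y⁆⇒x≡y v (subst (_ ∈_) Q─P≡v (x∈p∧x∉q⇒x∈p─q x∈Q x∉P))
    ; ∈P─Q⇒v~ = λ u∈P u∉Q → P─Q⊆N[v] _ (x∈p∧x∉q⇒x∈p─q u∈P u∉Q)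
    }
    where
    v∈Q─P : v ∈ Q ─ P
    v∈Q─P = subst (v ∈_) (sym Q─P≡v) (x∈⁅x⁆ v)

  two-added⇒¬Step : ∀ {P Q v x y} → x ∈ Q → x ∉ P → y ∈ Q → y ∉ P → x ≢ y → ¬ Step G P Q v
  two-added⇒¬Step x∈Q x∉P y∈Q y∉P x≢y st = x≢y (trans (∈Q─P⇒≡v x∈Q x∉P) (sym (∈Q─P⇒≡v y∈Q y∉P)))
    where open IsStep (Step⁻ st)

  pair-exchange : ∀ {a c d} → a ≢ d → c ≢ d → d ~ c → Step G (pair a c) (pair a d) d
  pair-exchange {a} {c} {d} a≢d c≢d d~c = Step⁺ record
    { v∈Q     = j∈pair
    ; v∉P     = ∉pair (a≢d ∘ sym) (c≢d ∘ sym)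
    ; ∈Q─P⇒≡v = λ x∈Q x∉P → [ (λ x≡a → contradiction (subst (_∈ pair a c) (sym x≡a) i∈pair) x∉P) , id ]′
                               (∈pair⁻ x∈Q)
    ; ∈P─Q⇒v~ = λ u∈P u∉Q → [ (λ u≡a → contradiction (subst (_∈ pair a d) (sym u≡a) i∈pair) u∉Q)
                             , (λ u≡c → subst (d ~_) (sym u≡c) d~c) ]′ (∈pair⁻ u∈P)
    }

  Adjᴿ : Subset n → Subset n → Set
  Adjᴿ P Q = ∃ λ v → Step G P Q v ⊎ Step G Q P v

  Adjᴿ-comm : ∀ {P Q} → Adjᴿ P Q ⇔ Adjᴿ Q P
  Adjᴿ-comm = mk⇔ (map₂ Sum.swap) (map₂ Sum.swap)

-- Some part must exist: for ℓ = 0 the empty set is a minimal dominating set of K [] and AFR [] is empty.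
module _ {ℓ : ℕ} (ns : Vec ℕ (suc ℓ)) (ns≥2 : ∀ k → 2 ≤ lookup ns k) where

  private
    G = K ns
    b = block ns

  twoInBlock : ∀ k → ∃₂ λ x y → x ≢ y × b x ≡ k × b y ≡ k
  twoInBlock k =
    let (s , t , s≢t) = twoDistinct (ns≥2 k) in
    element ns k s , element ns k t , s≢t ∘ element-injective ns k ,
    block-element ns k s , block-element ns k t

  anotherInBlock : ∀ k w → ∃ λ x → x ≢ w × b x ≡ k
  anotherInBlock k w with twoInBlock k
  ... | x , y , x≢y , bx≡k , by≡k with x ≟ w
  ...   | yes x≡w = y , (λ y≡w → x≢y (trans x≡w (sym y≡w))) , by≡k
  ...   | no  x≢w = x , x≢w , bx≡k

  part : Fin (suc ℓ) → Subset (sum ns)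
  part k = ⟦ (λ x → b x ≟ k) ⟧

  ∈part⁺ : ∀ {k x} → b x ≡ k → x ∈ part k
  ∈part⁺ {k} = ∈⟦⟧⁺ (λ x → b x ≟ k)

  ∈part⁻ : ∀ {k x} → x ∈ part k → b x ≡ k
  ∈part⁻ {k} = ∈⟦⟧⁻ (λ x → b x ≟ k)

  part-minDominating : ∀ k → MinDominating G (part k)
  part-minDominating k = privateNeighbours⇒minDominating G dom (λ x∈ → _ , selfPrivate x∈)
    where
    dom : Dominating G (part k)
    dom v with b v ≟ k
    ... | yes bv≡k = inj₁ (∈part⁺ bv≡k)
    ... | no  bv≢k = let (x , _ , _ , bx≡k , _) = twoInBlock k in
                     inj₂ (x , ∈part⁺ bx≡k , λ bv≡bx → bv≢k (trans bv≡bx bx≡k))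
    selfPrivate : ∀ {x} → x ∈ part k → PrivateNeighbour G (part k) x x
    selfPrivate _  _  (inj₁ u≡x)   = u≡x
    selfPrivate x∈ u∈ (inj₂ bx≢bu) = contradiction (trans (∈part⁻ x∈) (sym (∈part⁻ u∈))) bx≢bu

  pair-dominating : ∀ {i j} → b i ≢ b j → Dominating G (pair i j)
  pair-dominating {i} {j} bi≢bj v with b v ≟ b i
  ... | yes bv≡bi = inj₂ (j , j∈pair , λ bv≡bj → bi≢bj (trans (sym bv≡bi) bv≡bj))
  ... | no  bv≢bi = inj₂ (i , i∈pair , bv≢bi)

  pair-privateNeighbour : ∀ {i j} → b i ≢ b j → ∃ (PrivateNeighbour G (pair i j) i)
  pair-privateNeighbour {i} {j} bi≢bj with anotherInBlock (b j) j
  ... | w , w≢j , bw≡bj = w , onlyI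
    where
    onlyI : PrivateNeighbour G (pair i j) i w
    onlyI u∈ near with ∈pair⁻ u∈
    ... | inj₁ u≡i = u≡i
    ... | inj₂ refl = contradiction near [ w≢j ∘ sym , (λ bw≢bj → bw≢bj bw≡bj) ]′

  pair-minDominating : ∀ {i j} → b i ≢ b j → MinDominating G (pair i j)
  pair-minDominating {i} {j} bi≢bj = privateNeighbours⇒minDominating G (pair-dominating bi≢bj) pn
    where
    pn : ∀ {x} → x ∈ pair i j → ∃ (PrivateNeighbour G (pair i j) x)
    pn x∈ with ∈pair⁻ x∈
    ... | inj₁ refl = pair-privateNeighbour bi≢bj
    ... | inj₂ refl =
      subst (λ S → ∃ (PrivateNeighbour G S _)) (pair-comm j i) (pair-privateNeighbour (bi≢bj ∘ sym))

  dominating-⊆part⇒≡ : ∀ {S k} → Dominating G S → S ⊆ part k → part k ≡ S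
  dominating-⊆part⇒≡ {S} {k} dom S⊆part = ⊆-antisym part⊆S S⊆part
    where
    part⊆S : part k ⊆ S
    part⊆S {x} x∈ with dom x
    ... | inj₁ x∈S = x∈S
    ... | inj₂ (u , u∈S , bx≢bu) = contradiction (trans (∈part⁻ x∈) (sym (∈part⁻ (S⊆part u∈S)))) bx≢bu

  minDominating⇒part⊎pair : ∀ {S} → MinDominating G S →
    (∃ λ k → part k ≡ S) ⊎ (∃₂ λ i j → b i ≢ b j × pair i j ≡ S)
  minDominating⇒part⊎pair {S} mds@(dom , _) with dominating⇒nonempty G (proj₁ (twoInBlock zero)) dom
  ... | i , i∈S with any? (λ j → (j ∈? S) ×-dec ¬? (b i ≟ b j))
  ...   | yes (j , j∈S , bi≢bj) =
          inj₂ (i , j , bi≢bj , minDominating-⊆-dominating⇒≡ G mds pair⊆S (pair-dominating bi≢bj))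
    where
    pair⊆S : pair i j ⊆ S
    pair⊆S x∈ = [ (λ x≡i → subst (_∈ S) (sym x≡i) i∈S) , (λ x≡j → subst (_∈ S) (sym x≡j) j∈S) ]′
                (∈pair⁻ x∈)
  ...   | no ∄j = inj₁ (b i , dominating-⊆part⇒≡ dom S⊆part)
    where
    S⊆part : S ⊆ part (b i)
    S⊆part {x} x∈S with b i ≟ b x
    ... | yes bi≡bx = ∈part⁺ (sym bi≡bx)
    ... | no  bi≢bx = contradiction (x , x∈S , bi≢bx) ∄j

  part-part-¬Step : ∀ {k m v} → ¬ Step G (part k) (part m) v
  part-part-¬Step {k} {m} st with twoInBlock m
  ... | x , y , x≢y , bx≡m , by≡m =
    two-added⇒¬Step G (∈part⁺ bx≡m) (notIn bx≡m) (∈part⁺ by≡m) (notIn by≡m) x≢y st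
    where
    open IsStep (Step⁻ G st)
    notIn : ∀ {z} → b z ≡ m → z ∉ part k
    notIn bz≡m z∈k = v∉P (∈part⁺ (trans (trans (∈part⁻ v∈Q) (sym bz≡m)) (∈part⁻ z∈k)))

  part→pair-Step : ∀ {k i j} → b i ≡ k → b i ≢ b j → Step G (part k) (pair i j) j
  part→pair-Step {k} {i} {j} bi≡k bi≢bj = Step⁺ G record
    { v∈Q     = j∈pair
    ; v∉P     = λ j∈k → bi≢bj (trans bi≡k (sym (∈part⁻ j∈k)))
    ; ∈Q─P⇒≡v = λ x∈ x∉k → [ (λ x≡i → contradiction (∈part⁺ (trans (cong b x≡i) bi≡k)) x∉k) , id ]′
                             (∈pair⁻ x∈)
    ; ∈P─Q⇒v~ = λ u∈k _ bj≡bu → bi≢bj (trans bi≡k (trans (sym (∈part⁻ u∈k)) (sym bj≡bu)))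
    }

  part-pair-Adjᴿ : ∀ {k i j} → b i ≢ b j → (b i ≡ k ⊎ b j ≡ k) ⇔ Adjᴿ G (part k) (pair i j)
  part-pair-Adjᴿ {k} {i} {j} bi≢bj = mk⇔ meets⇒adj adj⇒meets
    where
    meets⇒adj : b i ≡ k ⊎ b j ≡ k → Adjᴿ G (part k) (pair i j)
    meets⇒adj (inj₁ bi≡k) = j , inj₁ (part→pair-Step bi≡k bi≢bj)
    meets⇒adj (inj₂ bj≡k) =
      i , inj₁ (subst (λ P → Step G (part k) P i) (pair-comm j i) (part→pair-Step bj≡k (bi≢bj ∘ sym)))
    adj⇒meets : Adjᴿ G (part k) (pair i j) → b i ≡ k ⊎ b j ≡ k
    adj⇒meets (v , st) with b i ≟ k | b j ≟ k
    ... | yes bi≡k | _        = inj₁ bi≡k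
    ... | no  _    | yes bj≡k = inj₂ bj≡k
    ... | no  bi≢k | no  bj≢k with twoInBlock k
    ...   | x , y , x≢y , bx≡k , by≡k = contradiction st
            [ two-added⇒¬Step G i∈pair (bi≢k ∘ ∈part⁻) j∈pair (bj≢k ∘ ∈part⁻) (bi≢bj ∘ cong b)
            , two-added⇒¬Step G (∈part⁺ bx≡k) (notIn bx≡k) (∈part⁺ by≡k) (notIn by≡k) x≢y ]′
      where
      notIn : ∀ {z} → b z ≡ k → z ∉ pair i j
      notIn bz≡k = ∉pair (λ z≡i → bi≢k (trans (cong b (sym z≡i)) bz≡k))
                         (λ z≡j → bj≢k (trans (cong b (sym z≡j)) bz≡k))

  PairsAdjacent : Fin (sum ns) × Fin (sum ns) → Fin (sum ns) × Fin (sum ns) → Set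
  PairsAdjacent p q = p ≢ q × Meet ns p q × ¬ SameBlocks ns p q

  PairsAdjacent-sym : ∀ {p q} → PairsAdjacent p q → PairsAdjacent q p
  PairsAdjacent-sym (p≢q , meet , ¬same) =
    p≢q ∘ sym , Meet-sym meet , λ (k , m , k≢m , q∈ , p∈) → ¬same (k , m , k≢m , p∈ , q∈)
    where
    Meet-sym : ∀ {p q} → Meet ns p q → Meet ns q p
    Meet-sym (inj₁ e)               = inj₁ (sym e)
    Meet-sym (inj₂ (inj₁ e))        = inj₂ (inj₂ (inj₁ (sym e)))
    Meet-sym (inj₂ (inj₂ (inj₁ e))) = inj₂ (inj₁ (sym e))
    Meet-sym (inj₂ (inj₂ (inj₂ e))) = inj₂ (inj₂ (inj₂ (sym e)))

  pair-Step⇒adjacent : ∀ {i j i′ j′ v} → b i′ ≢ b j′ →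
    Step G (pair i j) (pair i′ j′) v → PairsAdjacent (i , j) (i′ , j′)
  pair-Step⇒adjacent {i} {j} {i′} {j′} {v} bi′≢bj′ st = distinct , meet , ¬sameBlocks
    where
    open IsStep (Step⁻ G st)
    distinct : (i , j) ≢ (i′ , j′)
    distinct eq = v∉P (subst (λ p → v ∈ pair (proj₁ p) (proj₂ p)) (sym eq) v∈Q)
    meet : Meet ns (i , j) (i′ , j′)
    meet with i′ ∈? pair i j | j′ ∈? pair i j
    ... | yes i′∈ | _       = [ inj₁ ∘ sym , inj₂ ∘ inj₂ ∘ inj₁ ∘ sym ]′ (∈pair⁻ i′∈)
    ... | no _    | yes j′∈ = [ inj₂ ∘ inj₁ ∘ sym , inj₂ ∘ inj₂ ∘ inj₂ ∘ sym ]′ (∈pair⁻ j′∈)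
    ... | no i′∉  | no j′∉  = contradiction st (two-added⇒¬Step G i∈pair i′∉ j∈pair j′∉ (bi′≢bj′ ∘ cong b))
    kept : ∀ {x} → x ∈ pair i j → b x ≡ b v → x ∈ pair i′ j′
    kept {x} x∈P bx≡bv with x ∈? pair i′ j′
    ... | yes x∈Q = x∈Q
    ... | no  x∉Q = contradiction (sym bx≡bv) (∈P─Q⇒v~ x∈P x∉Q)
    -- The vertex of pair i j in the part of v is kept, but v is the only vertex of pair i′ j′ there.
    ¬sameBlocks : ¬ SameBlocks ns (i , j) (i′ , j′)
    ¬sameBlocks (k , m , k≢m , (bi≡k , bj≡m) , (bi′≡k , bj′≡m)) with ∈pair⁻ v∈Q
    ... | inj₁ v≡i′ =
      [ (λ i≡i′ → v∉P (subst (_∈ pair i j) (trans i≡i′ (sym v≡i′)) i∈pair))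
      , (λ i≡j′ → k≢m (trans (sym bi≡k) (trans (cong b i≡j′) bj′≡m))) ]′
      (∈pair⁻ (kept i∈pair (trans bi≡k (sym (trans (cong b v≡i′) bi′≡k)))))
    ... | inj₂ v≡j′ =
      [ (λ j≡i′ → k≢m (trans (sym bi′≡k) (trans (cong b (sym j≡i′)) bj≡m)))
      , (λ j≡j′ → v∉P (subst (_∈ pair i j) (trans j≡j′ (sym v≡j′)) j∈pair)) ]′
      (∈pair⁻ (kept j∈pair (trans bj≡m (sym (trans (cong b v≡j′) bj′≡m)))))

  adjacent⇒pair-Step : ∀ {i j i′ j′} → j Fin.< i → j′ Fin.< i′ → b i ≢ b j → b i′ ≢ b j′ →
    PairsAdjacent (i , j) (i′ , j′) → ∃ (Step G (pair i j) (pair i′ j′))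
  adjacent⇒pair-Step {i} {j} {.i} {j′} _ _ bi≢bj bi≢bj′ (distinct , inj₁ refl , ¬same) =
    j′ , pair-exchange G (bi≢bj′ ∘ cong b) (distinct ∘ cong (i ,_))
                       (λ bj′≡bj → ¬same (b i , b j , bi≢bj , (refl , refl) , (refl , bj′≡bj)))
  adjacent⇒pair-Step {i} {j} {i′} {.j} _ _ bi≢bj bi′≢bj (distinct , inj₂ (inj₂ (inj₂ refl)) , ¬same) =
    i′ , subst₂ (λ P Q → Step G P Q i′) (pair-comm j i) (pair-comm j i′)
                (pair-exchange G (bi′≢bj ∘ cong b ∘ sym) (distinct ∘ cong (_, j))
                                 (λ bi′≡bi → ¬same (b i , b j , bi≢bj , (refl , refl) , (bi′≡bi , refl))))
  adjacent⇒pair-Step {i} {j} {i′} {.i} j<i i<i′ bi≢bj bi′≢bi (_ , inj₂ (inj₁ refl) , _) =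
    i′ , subst (λ Q → Step G (pair i j) Q i′) (pair-comm i i′)
               (pair-exchange G (bi′≢bi ∘ cong b ∘ sym) (λ j≡i′ → <-irrefl j≡i′ (<-trans j<i i<i′))
                                (λ bi′≡bj → bi≢bj (block-convex ns (ℕ.<⇒≤ j<i) (ℕ.<⇒≤ i<i′) (sym bi′≡bj))))
  adjacent⇒pair-Step {i} {j} {.j} {j′} j<i j′<j bi≢bj bj≢bj′ (_ , inj₂ (inj₂ (inj₁ refl)) , _) =
    j′ , subst (λ P → Step G P (pair j j′) j′) (pair-comm j i)
               (pair-exchange G (bj≢bj′ ∘ cong b) (λ i≡j′ → <-irrefl (sym i≡j′) (<-trans j′<j j<i))
                                (λ bj′≡bi → bj≢bj′ (block-convex ns (ℕ.<⇒≤ j′<j) (ℕ.<⇒≤ j<i) bj′≡bi)))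

  pair-pair-Adjᴿ : ∀ {i j i′ j′} → j Fin.< i → j′ Fin.< i′ → b i ≢ b j → b i′ ≢ b j′ →
    PairsAdjacent (i , j) (i′ , j′) ⇔ Adjᴿ G (pair i j) (pair i′ j′)
  pair-pair-Adjᴿ j<i j′<i′ bi≢bj bi′≢bj′ = mk⇔
    (map₂ inj₁ ∘ adjacent⇒pair-Step j<i j′<i′ bi≢bj bi′≢bj′)
    λ { (_ , inj₁ st) → pair-Step⇒adjacent bi′≢bj′ st
      ; (_ , inj₂ st) → PairsAdjacent-sym (pair-Step⇒adjacent bi≢bj st) }

  toSubset : AFRV ns → Subset (sum ns)
  toSubset (inj₁ k)             = part k
  toSubset (inj₂ ((i , j) , _)) = pair i j

  toSubset-minDominating : ∀ a → MinDominating G (toSubset a)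
  toSubset-minDominating (inj₁ k)                     = part-minDominating k
  toSubset-minDominating (inj₂ ((i , j) , _ , bi≢bj)) = pair-minDominating (toWitnessFalse bi≢bj)

  toMDS : AFRV ns → MDS G
  toMDS a = toSubset a , fromWitness (toSubset-minDominating a)

  Pair-≡ : {p q : Pair ns} → proj₁ p ≡ proj₁ q → p ≡ q
  Pair-≡ {_ , j<i , bi≢bj} {_ , j<i′ , bi≢bj′} refl =
    cong₂ (λ x y → _ , x , y) (T-irrelevant j<i j<i′) (T-irrelevant bi≢bj bi≢bj′)

  toSubset-injective : ∀ {a c} → toSubset a ≡ toSubset c → a ≡ c
  toSubset-injective {inj₁ k} {inj₁ m} eq =
    let (x , _ , _ , bx≡k , _) = twoInBlock k in
    cong inj₁ (trans (sym bx≡k) (∈part⁻ (subst (x ∈_) eq (∈part⁺ bx≡k))))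
  toSubset-injective {inj₁ k} {inj₂ ((i , j) , _ , bi≢bj)} eq =
    contradiction (trans (∈part⁻ (subst (i ∈_) (sym eq) i∈pair))
                         (sym (∈part⁻ (subst (j ∈_) (sym eq) j∈pair))))
                  (toWitnessFalse bi≢bj)
  toSubset-injective {inj₂ p} {inj₁ k} eq with toSubset-injective {inj₁ k} {inj₂ p} (sym eq)
  ... | ()
  toSubset-injective {inj₂ ((i , j) , j<i , _)} {inj₂ ((i′ , j′) , j′<i′ , _)} eq =
    let (i≡i′ , j≡j′) = pair-injective (toWitness j<i) (toWitness j′<i′) eq in
    cong inj₂ (Pair-≡ (cong₂ _,_ i≡i′ j≡j′))

  sortPair : ∀ {i j} → b i ≢ b j → ∃ λ (p : Pair ns) → toSubset (inj₂ p) ≡ pair i j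
  sortPair {i} {j} bi≢bj with <-cmp i j
  ... | tri< i<j _ _ = ((j , i) , fromWitness i<j , fromWitnessFalse (bi≢bj ∘ sym)) , pair-comm j i
  ... | tri≈ _ i≡j _ = contradiction (cong b i≡j) bi≢bj
  ... | tri> _ _ j<i = ((i , j) , fromWitness j<i , fromWitnessFalse bi≢bj) , refl

  toMDS-surjective : ∀ M → ∃ λ a → toMDS a ≡ M
  toMDS-surjective (S , isMin) with minDominating⇒part⊎pair (toWitness isMin)
  ... | inj₁ (k , part≡S) = inj₁ k , MDS-≡ G part≡S
  ... | inj₂ (i , j , bi≢bj , pair≡S) =
    let (p , p≡pair) = sortPair bi≢bj in inj₂ p , MDS-≡ G (trans p≡pair pair≡S)

  toSubset-Adjᴿ : ∀ a c → AFRAdj ns a c ⇔ Adjᴿ G (toSubset a) (toSubset c)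
  toSubset-Adjᴿ (inj₁ k) (inj₁ m) =
    mk⇔ (λ ()) λ { (_ , inj₁ st) → part-part-¬Step st ; (_ , inj₂ st) → part-part-¬Step st }
  toSubset-Adjᴿ (inj₁ k) (inj₂ ((i , j) , _ , bi≢bj)) = part-pair-Adjᴿ (toWitnessFalse bi≢bj)
  toSubset-Adjᴿ (inj₂ ((i , j) , _ , bi≢bj)) (inj₁ k) =
    ⇔.trans (part-pair-Adjᴿ (toWitnessFalse bi≢bj)) (Adjᴿ-comm G)
  toSubset-Adjᴿ (inj₂ ((i , j) , j<i , bi≢bj)) (inj₂ ((i′ , j′) , j′<i′ , bi′≢bj′)) =
    pair-pair-Adjᴿ (toWitness j<i) (toWitness j′<i′) (toWitnessFalse bi≢bj) (toWitnessFalse bi′≢bj′)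

  AFR≅R[K] : AFR ns ≅ R (K ns)
  AFR≅R[K] =
    mk⤖ {to = toMDS} (toSubset-injective ∘ cong proj₁ , strictlySurjective⇒surjective toMDS-surjective) ,
    toSubset-Adjᴿ

theorem6 : (ℓ : ℕ) (ns : Vec ℕ ℓ) → 2 ≤ ℓ → (∀ (k : Fin ℓ) → 2 ≤ lookup ns k) →
           R (K ns) ≅ AFR ns
theorem6 (suc ℓ) ns _ ns≥2 = ≅-sym (AFR≅R[K] ns ns≥2)
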